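{- Let $T\subseteq S$. For each $k\ge1$ consider the following permutations of length $k$ in one-line notation: $\mathrm{id}_k=1\,2\cdots k$; $u_k=k\,2\,3\cdots(k-1)\,1$; $v_k=k\,1\,2\cdots(k-1)$; $w_k=2\,3\cdots k\,1$; $x_k=2\,1\,3\cdots k$; $y_k=1\,2\cdots(k-2)\,k\,(k-1)$; and, for $2\le r\le k$, the adjacent transposition $t_{k,r}=(r-1,\;r)\in S_k$. If at least one of the following holds: (a) $T\cap\{u_k,v_k,w_k,\mathrm{id}_k : k\ge1\}=\emptyset$; (b) $T\cap\{\mathrm{id}_k,\ t_{k,r} : 2\le r\le k,\ k\ge1\}=\emptyset$; (c) $T\cap\{w_k,\mathrm{id}_k,x_k : k\ge1\}=\emptyset$; (d) $T\cap\{y_k,\mathrm{id}_k,w_k : k\ge1\}=\emptyset$; then $\langle S_n(T)\rangle=S_n$ for every $n$. In particular: (i) if $T\subseteq S_3$ and $\langle S_n(T)\rangle\ne S_n$, then $T$ shares at least one element with each of the sets $\{123,231,312,321\}$, $\{123,132,213\}$, $\{123,213,231\}$ and $\{123,132,231\}$; (ii) if $T\subseteq S_4$ and $\langle S_n(T)\rangle\neq S_n$, then $T$ shares at least one element with each of the sets $\{1234,2341,4123,4231\}$, $\{1234,1243,1324,2134\}$, $\{1234,2134,2341\}$ and $\{1234,1243,2341\}$.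
   Context: $S_n$ is the symmetric group on $[n]$, permutations written in one-line notation or in cycle notation (with parentheses), $S=\bigcup_{n\ge0}S_n$. A permutation $\pi\in S_n$ contains the pattern $\tau\in S_k$ if some subsequence of $\pi$ of length $k$ is order-isomorphic to $\tau$; otherwise it avoids $\tau$. For $T\subseteq S$, $S_n(T)$ is the set of permutations in $S_n$ avoiding every pattern in $T$, and $\langle S_n(T)\rangle$ is the subgroup of $S_n$ it generates. -}

module Defs where

open import Data.Nat as ℕ using (ℕ; zero; suc; _≡ᵇ_)
open import Data.Bool using (if_then_else_)
open import Data.Fin as Fin using (Fin; toℕ; #_)
open import Data.Vec using (Vec; []; _∷_; lookup; tabulate; allFin)
open import Data.Product using (Σ; ∃; _×_; _,_)
open import Data.Sum using (_⊎_)
open import Relation.Nullary using (¬_)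
open import Relation.Binary.PropositionalEquality using (_≡_)
open import Function.Bundles using (_⇔_)

-- Permutations of [n] in one-line notation, 0-indexed: the vector
-- (π(1), ..., π(n)) with values shifted down by one, stored in Fin n.
IsPerm : ∀ {n} → Vec (Fin n) n → Set
IsPerm {n} π = ∀ (i j : Fin n) → lookup π i ≡ lookup π j → i ≡ j

Contains : ∀ {n k} → Vec (Fin n) n → Vec (Fin k) k → Set
Contains {n} {k} π τ =
  Σ (Fin k → Fin n) λ f →
    (∀ i j → i Fin.< j → f i Fin.< f j) ×
    (∀ i j → (lookup τ i Fin.< lookup τ j) ⇔ (lookup π (f i) Fin.< lookup π (f j)))

-- A set T ⊆ S of patterns, given as a predicate on vectors of each length.
-- Only those members that are permutations act as patterns.
PatternSet : Set₁
PatternSet = (k : ℕ) → Vec (Fin k) k → Set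

Avoids : PatternSet → ∀ {n} → Vec (Fin n) n → Set
Avoids T π = ∀ k (τ : Vec (Fin k) k) → T k τ → IsPerm τ → ¬ Contains π τ

compose : ∀ {n} → Vec (Fin n) n → Vec (Fin n) n → Vec (Fin n) n
compose σ τ = tabulate (λ i → lookup σ (lookup τ i))

data Gen {n : ℕ} (X : Vec (Fin n) n → Set) : Vec (Fin n) n → Set where
  gen : ∀ {g} → X g → IsPerm g → Gen X g
  one : Gen X (allFin n)
  mul : ∀ {g h} → Gen X g → Gen X h → Gen X (compose g h)
  inv : ∀ {g h} → Gen X g → (∀ i → lookup g (lookup h i) ≡ i) → Gen X h

GeneratesSym : PatternSet → ℕ → Set
GeneratesSym T n = ∀ (π : Vec (Fin n) n) → IsPerm π → Gen (λ σ → Avoids T σ) π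

-- helper: ℕ → Fin (suc m), (clamped at m; only used with values ≤ m)
toFin : ∀ m → ℕ → Fin (suc m)
toFin zero _ = Fin.zero
toFin (suc m) zero = Fin.zero
toFin (suc m) (suc x) = Fin.suc (toFin m x)

mk : ∀ m → (ℕ → ℕ) → Vec (Fin (suc m)) (suc m)
mk m f = tabulate (λ i → toFin m (f (toℕ i)))

-- Families (k = suc m, so k ≥ 1; for x, y: k = suc (suc m) ≥ 2)
-- id_k = 1 2 ... k
idP : ∀ m → Vec (Fin (suc m)) (suc m)
idP m = mk m (λ i → i)

uP : ∀ m → Vec (Fin (suc m)) (suc m)
uP m = mk m (λ i → if i ≡ᵇ 0 then m else (if i ≡ᵇ m then 0 else i))

vP : ∀ m → Vec (Fin (suc m)) (suc m)
vP m = mk m f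
  where
  f : ℕ → ℕ
  f zero = m
  f (suc i) = i

wP : ∀ m → Vec (Fin (suc m)) (suc m)
wP m = mk m (λ i → if i ≡ᵇ m then 0 else suc i)

-- x_k = 2 1 3 ... k   (k = m + 2)
xP : ∀ m → Vec (Fin (suc (suc m))) (suc (suc m))
xP m = mk (suc m) (λ i → if i ≡ᵇ 0 then 1 else (if i ≡ᵇ 1 then 0 else i))

-- y_k = 1 2 ... (k-2) k (k-1)   (k = m + 2)
yP : ∀ m → Vec (Fin (suc (suc m))) (suc (suc m))
yP m = mk (suc m) (λ i → if i ≡ᵇ m then suc m else (if i ≡ᵇ suc m then m else i))

-- t_{k,r} = (r-1, r) ∈ S_k, k = suc m, (intended for 2 ≤ r ≤ k)
tP : ∀ m (r : ℕ) → Vec (Fin (suc m)) (suc m)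
tP m r = mk m (λ i → if i ≡ᵇ (r ℕ.∸ 2) then r ℕ.∸ 1 else (if i ≡ᵇ (r ℕ.∸ 1) then r ℕ.∸ 2 else i))

CondA CondB CondC CondD : PatternSet → Set
CondA T = ∀ m → ¬ T (suc m) (uP m) × ¬ T (suc m) (vP m) × ¬ T (suc m) (wP m) × ¬ T (suc m) (idP m)
CondB T = (∀ m → ¬ T (suc m) (idP m)) ×
          (∀ m r → 2 ℕ.≤ r → r ℕ.≤ suc m → ¬ T (suc m) (tP m r))
CondC T = ∀ m → ¬ T (suc m) (wP m) × ¬ T (suc m) (idP m) × ¬ T (suc (suc m)) (xP m)
CondD T = ∀ m → ¬ T (suc m) (wP m) × ¬ T (suc m) (idP m) × ¬ T (suc (suc m)) (yP m)

SubsetOfS : PatternSet → ℕ → Set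
SubsetOfS T k = ∀ j τ → T j τ → j ≡ k

open import Data.List using (List; []; _∷_)
open import Data.List.Relation.Unary.All using (All)
Meets : PatternSet → ∀ k → List (Vec (Fin k) k) → Set
Meets T k A = ¬ All (λ a → ¬ T k a) A

p3 : ℕ → ℕ → ℕ → Vec (Fin 3) 3
p3 a b c = toFin 2 a ∷ toFin 2 b ∷ toFin 2 c ∷ []

p4 : ℕ → ℕ → ℕ → ℕ → Vec (Fin 4) 4
p4 a b c d = toFin 3 a ∷ toFin 3 b ∷ toFin 3 c ∷ toFin 3 d ∷ []

{-# OPTIONS --safe #-}
module Submission where

-- Let w = 2 3 ⋯ n 1. Reading off the relative order of an occurrence shows that every pattern of w is
-- id or w, every pattern of the transposition (1 n) is id, u, v or w, and every pattern of an adjacent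
-- transposition (c c+1) is id or some t_{k,r}, which is x when c = 1 and y when c = n − 1. Hence T is
-- avoided by w and (1 n) under (a), by all adjacent transpositions under (b), by w and (1 2) under (c)
-- and by w and (n−1 n) under (d). Conjugation by w sends (c c+1) to (c+1 c+2), (1 n) to (1 2) and
-- (n−1 n) to (1 n), so in every case the avoiders generate all adjacent transpositions, hence S_n.
-- For T ⊆ S_k the families in (a)–(d) can only meet T in length k, which gives (i) and (ii).

open import Defs
open import Data.Bool using (true; false; if_then_else_)
open import Data.Empty using (⊥-elim)
open import Data.Fin as Fin using (Fin; toℕ)
import Data.Fin.Properties as Finₚ
open import Data.List using (List; []; _∷_)
open import Data.List.Relation.Unary.All using (All; []; _∷_)
open import Data.Nat using (ℕ; zero; suc; _+_; _∸_; _≤_; _<_; _≡ᵇ_; z≤n; s≤s; _≟_)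
open import Data.Nat.Properties
open import Data.Product using (Σ; _×_; _,_; proj₁; proj₂)
open import Data.Sum using (_⊎_; inj₁; inj₂)
open import Data.Vec using (Vec; []; _∷_; lookup; allFin)
open import Data.Vec.Properties using (lookup∘tabulate; lookup-allFin; tabulate∘lookup; tabulate-cong)
open import Function.Base using (_∘_)
open import Function.Bundles using (Equivalence)
open import Relation.Binary.Definitions using (tri<; tri≈; tri>)
open import Relation.Binary.PropositionalEquality
open import Relation.Nullary using (¬_; yes; no)
open import Relation.Nullary.Decidable using (_×-dec_)

-- A permutation of [0..m] is handled as any function ℕ → ℕ that agrees with it on [0..m]; the vector
-- is then mk m P. All predicates below look at [0..m] only.

Bounded : ℕ → (ℕ → ℕ) → Set
Bounded m g = ∀ a → a ≤ m → g a ≤ m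

InjectiveOn : ℕ → (ℕ → ℕ) → Set
InjectiveOn m g = ∀ a b → a ≤ m → b ≤ m → g a ≡ g b → a ≡ b

IncreasingOn : ℕ → (ℕ → ℕ) → Set
IncreasingOn m F = ∀ a b → a < b → b ≤ m → F a < F b

record InverseOn (m : ℕ) (to from : ℕ → ℕ) : Set where
  field
    to-bounded   : Bounded m to
    from-bounded : Bounded m from
    from∘to      : ∀ a → a ≤ m → from (to a) ≡ a
    to∘from      : ∀ a → a ≤ m → to (from a) ≡ a

  to-injective : InjectiveOn m to
  to-injective a b a≤m b≤m eq = trans (sym (from∘to a a≤m)) (trans (cong from eq) (from∘to b b≤m))

inverseOn-sym : ∀ {m f g} → InverseOn m f g → InverseOn m g f
inverseOn-sym f⇔g = record
  { to-bounded = from-bounded ; from-bounded = to-bounded ; from∘to = to∘from ; to∘from = from∘to }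
  where open InverseOn f⇔g

id-inverse : ∀ {m} → InverseOn m (λ a → a) (λ a → a)
id-inverse = record
  { to-bounded = λ _ a≤m → a≤m ; from-bounded = λ _ a≤m → a≤m
  ; from∘to    = λ _ _ → refl  ; to∘from      = λ _ _ → refl }

module _ {m F} (F-increasing : IncreasingOn m F) where

  increasing-injective : InjectiveOn m F
  increasing-injective a b a≤m b≤m eq with <-cmp a b
  ... | tri< a<b _ _ = ⊥-elim (<⇒≢ (F-increasing a b a<b b≤m) eq)
  ... | tri≈ _ a≡b _ = a≡b
  ... | tri> _ _ b<a = ⊥-elim (<⇒≢ (F-increasing b a b<a a≤m) (sym eq))

  increasing-monotone : ∀ {a b} → a ≤ b → b ≤ m → F a ≤ F b
  increasing-monotone a≤b b≤m with m≤n⇒m<n∨m≡n a≤b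
  ... | inj₁ a<b  = <⇒≤ (F-increasing _ _ a<b b≤m)
  ... | inj₂ refl = ≤-refl

  increasing-inflationary : ∀ a → a ≤ m → a ≤ F a
  increasing-inflationary zero    _     = z≤n
  increasing-inflationary (suc a) 1+a≤m =
    ≤-<-trans (increasing-inflationary a (<⇒≤ 1+a≤m)) (F-increasing a (suc a) ≤-refl 1+a≤m)

  increasing-self-map⇒id : Bounded m F → ∀ a → a ≤ m → F a ≡ a
  increasing-self-map⇒id F-bounded a a≤m =
    ≤-antisym (deflationary (m ∸ a) a (m+[n∸m]≡n a≤m)) (increasing-inflationary a a≤m)
    where
    deflationary : ∀ d a → a + d ≡ m → F a ≤ a
    deflationary zero a a+0≡m = subst (F a ≤_) (sym a≡m) (F-bounded a (≤-reflexive a≡m))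
      where
      a≡m : a ≡ m
      a≡m = trans (sym (+-identityʳ a)) a+0≡m
    deflationary (suc d) a a+1+d≡m =
      ≤-pred (<-≤-trans (F-increasing a (suc a) ≤-refl 1+a≤m) (deflationary d (suc a) 1+a+d≡m))
      where
      1+a+d≡m : suc a + d ≡ m
      1+a+d≡m = trans (sym (+-suc a d)) a+1+d≡m
      1+a≤m : suc a ≤ m
      1+a≤m = ≤-trans (m≤m+n (suc a) d) (≤-reflexive 1+a+d≡m)

-- Transpositions and the long cycle

if-≡ᵇ-yes : ∀ {A : Set} {p a : ℕ} {x y : A} → p ≡ a → (if p ≡ᵇ a then x else y) ≡ x
if-≡ᵇ-yes {p = p} refl with p ≡ᵇ p | ≡⇒≡ᵇ p p refl
... | true | _ = refl

if-≡ᵇ-no : ∀ {A : Set} {p a : ℕ} {x y : A} → p ≢ a → (if p ≡ᵇ a then x else y) ≡ y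
if-≡ᵇ-no {p = p} {a} p≢a with p ≡ᵇ a | ≡ᵇ⇒≡ p a
... | true  | p≡a = ⊥-elim (p≢a (p≡a _))
... | false | _   = refl

-- Definitionally, mk m (swap 0 m) is uP m and mk m (swap e (suc e)) is tP m (2 + e).
swap : ℕ → ℕ → ℕ → ℕ
swap a b p = if p ≡ᵇ a then b else (if p ≡ᵇ b then a else p)

swap-left : ∀ a b → swap a b a ≡ b
swap-left a b = if-≡ᵇ-yes {p = a} refl

swap-right : ∀ a b → swap a b b ≡ a
swap-right a b with b ≟ a
... | yes b≡a = trans (if-≡ᵇ-yes b≡a) b≡a
... | no  b≢a = trans (if-≡ᵇ-no b≢a) (if-≡ᵇ-yes {p = b} refl)

swap-other : ∀ {a b p} → p ≢ a → p ≢ b → swap a b p ≡ p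
swap-other p≢a p≢b = trans (if-≡ᵇ-no p≢a) (if-≡ᵇ-no p≢b)

swap-self : ∀ a p → swap a a p ≡ p
swap-self a p with p ≟ a
... | yes refl = swap-left p p
... | no  p≢a  = swap-other p≢a p≢a

swap-comm : ∀ a b p → swap a b p ≡ swap b a p
swap-comm a b p with p ≟ a | p ≟ b
... | yes refl | _        = trans (swap-left p b) (sym (swap-right b p))
... | no  _    | yes refl = trans (swap-right a p) (sym (swap-left p a))
... | no  p≢a  | no  p≢b  = trans (swap-other p≢a p≢b) (sym (swap-other p≢b p≢a))

swap-involutive : ∀ a b p → swap a b (swap a b p) ≡ p
swap-involutive a b p with p ≟ a | p ≟ b
... | yes refl | _        = trans (cong (swap p b) (swap-left p b)) (swap-right p b)
... | no  _    | yes refl = trans (cong (swap a p) (swap-right a p)) (swap-left a p)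
... | no  p≢a  | no  p≢b  = trans (cong (swap a b) (swap-other p≢a p≢b)) (swap-other p≢a p≢b)

swap-injective : ∀ a b {p q} → swap a b p ≡ swap a b q → p ≡ q
swap-injective a b {p} {q} eq = begin
  p                      ≡⟨ swap-involutive a b p ⟨
  swap a b (swap a b p)  ≡⟨ cong (swap a b) eq ⟩
  swap a b (swap a b q)  ≡⟨ swap-involutive a b q ⟩
  q                      ∎
  where open ≡-Reasoning

swap-bounded : ∀ {m a b} → a ≤ m → b ≤ m → Bounded m (swap a b)
swap-bounded {m} {a} {b} a≤m b≤m p p≤m with p ≟ a | p ≟ b
... | yes refl | _        = subst (_≤ m) (sym (swap-left p b)) b≤m
... | no  _    | yes refl = subst (_≤ m) (sym (swap-right a p)) a≤m
... | no  p≢a  | no  p≢b  = subst (_≤ m) (sym (swap-other p≢a p≢b)) p≤m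

swap-inverse : ∀ {m a b} → a ≤ m → b ≤ m → InverseOn m (swap a b) (swap a b)
swap-inverse {a = a} {b} a≤m b≤m = record
  { to-bounded = swap-bounded a≤m b≤m        ; from-bounded = swap-bounded a≤m b≤m
  ; from∘to    = λ p _ → swap-involutive a b p ; to∘from      = λ p _ → swap-involutive a b p }

swap-natural : ∀ {m F a b p} → InjectiveOn m F → a ≤ m → b ≤ m → p ≤ m →
               F (swap a b p) ≡ swap (F a) (F b) (F p)
swap-natural {m} {F} {a} {b} {p} F-injective a≤m b≤m p≤m with p ≟ a | p ≟ b
... | yes refl | _        = trans (cong F (swap-left p b)) (sym (swap-left (F p) (F b)))
... | no  _    | yes refl = trans (cong F (swap-right a p)) (sym (swap-right (F a) (F p)))
... | no  p≢a  | no  p≢b  = trans (cong F (swap-other p≢a p≢b))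
  (sym (swap-other (p≢a ∘ F-injective p a p≤m a≤m) (p≢b ∘ F-injective p b p≤m b≤m)))

swap-adjacent-< : ∀ {c x y} → x < y → ¬ (x ≡ c × y ≡ suc c) → swap c (suc c) x < swap c (suc c) y
swap-adjacent-< {c} {x} {y} x<y ¬c,1+c with x ≟ c | x ≟ suc c
... | yes refl | _ = subst₂ _<_ (sym (swap-left x (suc x))) (sym (swap-other (>⇒≢ x<y) y≢1+x)) 1+x<y
  where
  y≢1+x : y ≢ suc x
  y≢1+x y≡1+x = ¬c,1+c (refl , y≡1+x)
  1+x<y : suc x < y
  1+x<y = ≤∧≢⇒< x<y (y≢1+x ∘ sym)
... | no _ | yes refl = subst₂ _<_ (sym (swap-right c x)) (sym (swap-other (>⇒≢ c<y) (>⇒≢ x<y))) c<y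
  where
  c<y : c < y
  c<y = <-trans ≤-refl x<y
... | no x≢c | no x≢1+c with y ≟ c | y ≟ suc c
...   | yes refl | _        = subst₂ _<_ (sym (swap-other x≢c x≢1+c)) (sym (swap-left y (suc y))) (<-trans x<y ≤-refl)
...   | no  _    | yes refl = subst₂ _<_ (sym (swap-other x≢c x≢1+c)) (sym (swap-right c y))
                                (≤∧≢⇒< (≤-pred x<y) x≢c)
...   | no  y≢c  | no  y≢1+c = subst₂ _<_ (sym (swap-other x≢c x≢1+c)) (sym (swap-other y≢c y≢1+c)) x<y

-- Definitionally, mk m (cycle m) is wP m and mk m (cycle⁻¹ m) is vP m.
cycle : ℕ → ℕ → ℕ
cycle m i = if i ≡ᵇ m then 0 else suc i

cycle⁻¹ : ℕ → ℕ → ℕ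
cycle⁻¹ m zero    = m
cycle⁻¹ m (suc i) = i

cycle-last : ∀ m → cycle m m ≡ 0
cycle-last m = if-≡ᵇ-yes {p = m} refl

cycle-< : ∀ {m i} → i < m → cycle m i ≡ suc i
cycle-< i<m = if-≡ᵇ-no (<⇒≢ i<m)

cycle-inverse : ∀ m → InverseOn m (cycle m) (cycle⁻¹ m)
cycle-inverse m = record
  { to-bounded = to-bounded ; from-bounded = from-bounded ; from∘to = from∘to ; to∘from = to∘from }
  where
  to-bounded : Bounded m (cycle m)
  to-bounded i i≤m with m≤n⇒m<n∨m≡n i≤m
  ... | inj₁ i<m  = subst (_≤ m) (sym (cycle-< i<m)) i<m
  ... | inj₂ refl = subst (_≤ m) (sym (cycle-last m)) z≤n
  from-bounded : Bounded m (cycle⁻¹ m)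
  from-bounded zero    _   = ≤-refl
  from-bounded (suc i) i<m = <⇒≤ i<m
  from∘to : ∀ i → i ≤ m → cycle⁻¹ m (cycle m i) ≡ i
  from∘to i i≤m with m≤n⇒m<n∨m≡n i≤m
  ... | inj₁ i<m  = cong (cycle⁻¹ m) (cycle-< i<m)
  ... | inj₂ refl = cong (cycle⁻¹ m) (cycle-last m)
  to∘from : ∀ i → i ≤ m → cycle m (cycle⁻¹ m i) ≡ i
  to∘from zero    _   = cycle-last m
  to∘from (suc i) i<m = cycle-< i<m

∘cycle-increasing : ∀ {m φ} → (∀ a b → a < b → b < m → φ (suc a) < φ (suc b)) →
                    (∀ a → a < m → φ (suc a) < φ 0) → IncreasingOn m (φ ∘ cycle m)
∘cycle-increasing {m} {φ} inner last a b a<b b≤m with m≤n⇒m<n∨m≡n b≤m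
... | inj₁ b<m  = subst₂ _<_ (cong φ (sym (cycle-< (<-trans a<b b<m)))) (cong φ (sym (cycle-< b<m)))
                         (inner a b a<b b<m)
... | inj₂ refl = subst₂ _<_ (cong φ (sym (cycle-< a<b))) (cong φ (sym (cycle-last b))) (last a a<b)

∘cycle⁻¹-increasing : ∀ {m φ} → (∀ a b → a < b → b < m → φ a < φ b) →
                      (∀ b → b < m → φ m < φ b) → IncreasingOn m (φ ∘ cycle⁻¹ m)
∘cycle⁻¹-increasing inner last zero    (suc b) _         b<m = last b b<m
∘cycle⁻¹-increasing inner last (suc a) (suc b) (s≤s a<b) b<m = inner a b a<b b<m

toℕ-toFin : ∀ m x → x ≤ m → toℕ (toFin m x) ≡ x
toℕ-toFin zero    zero    _         = refl
toℕ-toFin (suc m) zero    _         = refl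
toℕ-toFin (suc m) (suc x) (s≤s x≤m) = cong suc (toℕ-toFin m x x≤m)

toFin-toℕ : ∀ m (i : Fin (suc m)) → toFin m (toℕ i) ≡ i
toFin-toℕ zero    Fin.zero    = refl
toFin-toℕ (suc m) Fin.zero    = refl
toFin-toℕ (suc m) (Fin.suc i) = cong Fin.suc (toFin-toℕ m i)

toℕ-lookup-mk : ∀ {m P} → Bounded m P → (i : Fin (suc m)) → toℕ (lookup (mk m P) i) ≡ P (toℕ i)
toℕ-lookup-mk {m} {P} P-bounded i = begin
  toℕ (lookup (mk m P) i)    ≡⟨ cong toℕ (lookup∘tabulate (toFin m ∘ P ∘ toℕ) i) ⟩
  toℕ (toFin m (P (toℕ i)))  ≡⟨ toℕ-toFin m _ (P-bounded _ (Finₚ.toℕ≤pred[n] i)) ⟩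
  P (toℕ i)                  ∎
  where open ≡-Reasoning

mk-cong : ∀ {m P Q} → (∀ p → p ≤ m → P p ≡ Q p) → mk m P ≡ mk m Q
mk-cong {m} P≗Q = tabulate-cong (λ i → cong (toFin m) (P≗Q (toℕ i) (Finₚ.toℕ≤pred[n] i)))

compose-mk : ∀ {m P Q} → Bounded m Q → compose (mk m P) (mk m Q) ≡ mk m (P ∘ Q)
compose-mk {m} {P} {Q} Q-bounded = tabulate-cong λ i → begin
  lookup (mk m P) (lookup (mk m Q) i)    ≡⟨ lookup∘tabulate (toFin m ∘ P ∘ toℕ) (lookup (mk m Q) i) ⟩
  toFin m (P (toℕ (lookup (mk m Q) i)))  ≡⟨ cong (toFin m ∘ P) (toℕ-lookup-mk Q-bounded i) ⟩
  toFin m (P (Q (toℕ i)))                ∎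
  where open ≡-Reasoning

allFin-mk : ∀ m → allFin (suc m) ≡ mk m (λ p → p)
allFin-mk m = tabulate-cong (λ i → sym (toFin-toℕ m i))

mk-isPerm : ∀ {m P} → Bounded m P → InjectiveOn m P → IsPerm (mk m P)
mk-isPerm {m} {P} P-bounded P-injective i j eq = Finₚ.toℕ-injective
  (P-injective _ _ (Finₚ.toℕ≤pred[n] i) (Finₚ.toℕ≤pred[n] j)
    (trans (sym (toℕ-lookup-mk P-bounded i)) (trans (cong toℕ eq) (toℕ-lookup-mk P-bounded j))))

toFun : ∀ m → Vec (Fin (suc m)) (suc m) → ℕ → ℕ
toFun m π a = toℕ (lookup π (toFin m a))

toFun-bounded : ∀ m π → Bounded m (toFun m π)
toFun-bounded m π a _ = Finₚ.toℕ≤pred[n] (lookup π (toFin m a))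

toFun-injective : ∀ m π → IsPerm π → InjectiveOn m (toFun m π)
toFun-injective m π π-perm a b a≤m b≤m eq = begin
  a                ≡⟨ toℕ-toFin m a a≤m ⟨
  toℕ (toFin m a)  ≡⟨ cong toℕ (π-perm _ _ (Finₚ.toℕ-injective eq)) ⟩
  toℕ (toFin m b)  ≡⟨ toℕ-toFin m b b≤m ⟩
  b                ∎
  where open ≡-Reasoning

mk-toFun : ∀ m π → π ≡ mk m (toFun m π)
mk-toFun m π = trans (sym (tabulate∘lookup π)) (tabulate-cong λ i → begin
  lookup π i                   ≡⟨ cong (lookup π) (toFin-toℕ m i) ⟨
  lookup π (toFin m (toℕ i))   ≡⟨ toFin-toℕ m _ ⟨
  toFin m (toFun m π (toℕ i))  ∎)
  where open ≡-Reasoning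

-- Generating the symmetric group

module GeneratedSubgroup {N : ℕ} (X : Vec (Fin (suc N)) (suc N) → Set) where

  Generated : (ℕ → ℕ) → Set
  Generated P = Gen X (mk N P)

  generated-cong : ∀ {P Q} → (∀ p → p ≤ N → P p ≡ Q p) → Generated P → Generated Q
  generated-cong P≗Q = subst (Gen X) (mk-cong P≗Q)

  generated-id : Generated (λ p → p)
  generated-id = subst (Gen X) (allFin-mk N) one

  generated-∘ : ∀ {P Q} → Bounded N Q → Generated P → Generated Q → Generated (P ∘ Q)
  generated-∘ {P} {Q} Q-bounded gP gQ = subst (Gen X) (compose-mk {P = P} {Q} Q-bounded) (mul gP gQ)

  generated-inverse : ∀ {P Q} → InverseOn N P Q → Generated P → Generated Q
  generated-inverse {P} {Q} P⇔Q gP = inv gP λ i → begin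
    lookup (mk N P) (lookup (mk N Q) i)   ≡⟨ lookup∘tabulate (λ j → lookup (mk N P) (lookup (mk N Q) j)) i ⟨
    lookup (compose (mk N P) (mk N Q)) i  ≡⟨ cong (λ π → lookup π i) (compose-mk {P = P} from-bounded) ⟩
    lookup (mk N (P ∘ Q)) i               ≡⟨ cong (λ π → lookup π i) (mk-cong to∘from) ⟩
    lookup (mk N (λ p → p)) i             ≡⟨ cong (λ π → lookup π i) (allFin-mk N) ⟨
    lookup (allFin (suc N)) i             ≡⟨ lookup-allFin i ⟩
    i                                     ∎
    where
    open ≡-Reasoning
    open InverseOn P⇔Q

  generated-conjugate-swap : ∀ {σ σ′ a b} → InverseOn N σ σ′ → a ≤ N → b ≤ N →
                             Generated σ → Generated (swap a b) → Generated (swap (σ a) (σ b))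
  generated-conjugate-swap {σ} {σ′} {a} {b} σ⇔σ′ a≤N b≤N gσ gswap =
    generated-cong σ∘swap∘σ′≗swap
      (generated-∘ {P = σ ∘ swap a b} from-bounded (generated-∘ {P = σ} (swap-bounded a≤N b≤N) gσ gswap)
        (generated-inverse σ⇔σ′ gσ))
    where
    open InverseOn σ⇔σ′
    σ∘swap∘σ′≗swap : ∀ p → p ≤ N → σ (swap a b (σ′ p)) ≡ swap (σ a) (σ b) p
    σ∘swap∘σ′≗swap p p≤N = trans (swap-natural to-injective a≤N b≤N (from-bounded p p≤N))
                                 (cong (swap (σ a) (σ b)) (to∘from p p≤N))

  module _ (adjacent : ∀ c → suc c ≤ N → Generated (swap c (suc c))) where

    generated-swap : ∀ a b → a ≤ b → b ≤ N → Generated (swap a b)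
    generated-swap zero zero z≤n _ = generated-cong (λ p _ → sym (swap-self 0 p)) generated-id
    generated-swap a (suc b) a≤1+b 1+b≤N with m≤n⇒m<n∨m≡n a≤1+b
    ... | inj₂ refl = generated-cong (λ p _ → sym (swap-self a p)) generated-id
    ... | inj₁ (s≤s a≤b) with m≤n⇒m<n∨m≡n a≤b
    ...   | inj₂ refl = adjacent a 1+b≤N
    ...   | inj₁ a<b  = subst₂ (λ c d → Generated (swap c d)) sa≡a sb≡1+b
        (generated-conjugate-swap (swap-inverse b≤N 1+b≤N) a≤N b≤N (adjacent b 1+b≤N)
          (generated-swap a b a≤b b≤N))
      where
      b≤N : b ≤ N
      b≤N = <⇒≤ 1+b≤N
      a≤N : a ≤ N
      a≤N = ≤-trans a≤b b≤N
      sa≡a : swap b (suc b) a ≡ a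
      sa≡a = swap-other (<⇒≢ a<b) (<⇒≢ (m<n⇒m<1+n a<b))
      sb≡1+b : swap b (suc b) b ≡ suc b
      sb≡1+b = swap-left b (suc b)

    -- P = (j k) ∘ Q with k = P j ≥ j, where Q also fixes j.
    generated-fixing-below : ∀ d j → d + j ≡ suc N → ∀ P → Bounded N P → InjectiveOn N P →
                             (∀ p → p < j → P p ≡ p) → Generated P
    generated-fixing-below zero j refl P _ _ P-fixes =
      generated-cong (λ p p≤N → sym (P-fixes p (s≤s p≤N))) generated-id
    generated-fixing-below (suc d) j 1+d+j≡1+N P P-bounded P-injective P-fixes =
      generated-cong (λ p _ → swap-involutive j k (P p))
        (generated-∘ {P = swap j k} Q-bounded (generated-swap j k j≤k k≤N) gQ)
      where
      j≤N : j ≤ N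
      j≤N = ≤-pred (≤-trans (s≤s (m≤n+m j d)) (≤-reflexive 1+d+j≡1+N))
      k : ℕ
      k = P j
      k≤N : k ≤ N
      k≤N = P-bounded j j≤N
      j≤k : j ≤ k
      j≤k = ≮⇒≥ λ k<j → <⇒≢ k<j (P-injective k j k≤N j≤N (P-fixes k k<j))
      Q : ℕ → ℕ
      Q p = swap j k (P p)
      Q-bounded : Bounded N Q
      Q-bounded p p≤N = swap-bounded j≤N k≤N (P p) (P-bounded p p≤N)
      Q-fixes : ∀ p → p < suc j → Q p ≡ p
      Q-fixes p (s≤s p≤j) with m≤n⇒m<n∨m≡n p≤j
      ... | inj₁ p<j  = trans (cong (swap j k) (P-fixes p p<j)) (swap-other (<⇒≢ p<j) (<⇒≢ (<-≤-trans p<j j≤k)))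
      ... | inj₂ refl = swap-right p k
      gQ : Generated Q
      gQ = generated-fixing-below d (suc j) (trans (+-suc d j) 1+d+j≡1+N) Q Q-bounded
             (λ a b a≤N b≤N eq → P-injective a b a≤N b≤N (swap-injective j k eq)) Q-fixes

    generated-all : ∀ π → IsPerm π → Gen X π
    generated-all π π-perm = subst (Gen X) (sym (mk-toFun N π))
      (generated-fixing-below (suc N) 0 (+-identityʳ (suc N)) (toFun N π) (toFun-bounded N π)
        (toFun-injective N π π-perm) (λ _ ()))

  module _ (gcycle : Generated (cycle N)) where

    generated-cycle-conjugate : ∀ {a b} → a ≤ N → b ≤ N →
                                Generated (swap a b) → Generated (swap (cycle N a) (cycle N b))
    generated-cycle-conjugate a≤N b≤N = generated-conjugate-swap (cycle-inverse N) a≤N b≤N gcycle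

    generated-adjacent : (1 ≤ N → Generated (swap 0 1)) → ∀ c → suc c ≤ N → Generated (swap c (suc c))
    generated-adjacent g01 zero    1≤N   = g01 1≤N
    generated-adjacent g01 (suc c) 2+c≤N = subst₂ (λ a b → Generated (swap a b))
      (cycle-< (<⇒≤ 2+c≤N)) (cycle-< 2+c≤N)
      (generated-cycle-conjugate (<⇒≤ (<⇒≤ 2+c≤N)) (<⇒≤ 2+c≤N) (generated-adjacent g01 c (<⇒≤ 2+c≤N)))

    generated-first : Generated (swap 0 N) → 1 ≤ N → Generated (swap 0 1)
    generated-first g0N 1≤N = generated-cong (λ p _ → swap-comm 1 0 p)
      (subst₂ (λ a b → Generated (swap a b)) (cycle-< 1≤N) (cycle-last N)
        (generated-cycle-conjugate z≤n ≤-refl g0N))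

    generated-end : ∀ c → suc c ≡ N → Generated (swap c (suc c)) → Generated (swap 0 N)
    generated-end c refl gc = generated-cong (λ p _ → swap-comm (suc c) 0 p)
      (subst₂ (λ a b → Generated (swap a b)) (cycle-< ≤-refl) (cycle-last N)
        (generated-cycle-conjugate (n≤1+n c) ≤-refl gc))

-- Patterns of a cycle and of transpositions

-- Of the order-isomorphism in Contains only the direction that is used is kept.
record Occurrence (N m : ℕ) (P : ℕ → ℕ) (τ : Vec (Fin (suc m)) (suc m)) : Set where
  field
    pos            : ℕ → ℕ
    pos-increasing : IncreasingOn m pos
    pos-bounded    : ∀ a → pos a ≤ N
    reflects       : ∀ a b → a ≤ m → b ≤ m → P (pos a) < P (pos b) → toFun m τ a < toFun m τ b

  pos<N-before-last : ∀ {a} → a < m → pos a < N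
  pos<N-before-last a<m = <-≤-trans (pos-increasing _ m a<m ≤-refl) (pos-bounded m)

  pos<N-when-last≢N : pos m ≢ N → ∀ {a} → a ≤ m → pos a < N
  pos<N-when-last≢N last≢N a≤m = ≤∧≢⇒< (≤-trans pos-a≤pos-m (pos-bounded m))
    λ pos-a≡N → last≢N (≤-antisym (pos-bounded m) (subst (_≤ pos m) pos-a≡N pos-a≤pos-m))
    where
    pos-a≤pos-m : pos _ ≤ pos m
    pos-a≤pos-m = increasing-monotone pos-increasing a≤m ≤-refl

  pos>0-after-first : ∀ {a} → 0 < a → a ≤ m → 0 < pos a
  pos>0-after-first 0<a a≤m = ≤-<-trans z≤n (pos-increasing 0 _ 0<a a≤m)

  pos>0-when-first≢0 : pos 0 ≢ 0 → ∀ {a} → a ≤ m → 0 < pos a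
  pos>0-when-first≢0 first≢0 a≤m = <-≤-trans (n≢0⇒n>0 first≢0) (increasing-monotone pos-increasing z≤n a≤m)

contains⇒occurrence : ∀ {N m P} {τ : Vec (Fin (suc m)) (suc m)} →
                      Bounded N P → Contains (mk N P) τ → Occurrence N m P τ
contains⇒occurrence {N} {m} {P} {τ} P-bounded (f , f-increasing , f-order) = record
  { pos = pos ; pos-increasing = pos-increasing ; pos-bounded = λ a → Finₚ.toℕ≤pred[n] (f (toFin m a))
  ; reflects = reflects }
  where
  pos : ℕ → ℕ
  pos a = toℕ (f (toFin m a))
  pos-increasing : IncreasingOn m pos
  pos-increasing a b a<b b≤m = f-increasing _ _
    (subst₂ _<_ (sym (toℕ-toFin m a (<⇒≤ (<-≤-trans a<b b≤m)))) (sym (toℕ-toFin m b b≤m)) a<b)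
  reflects : ∀ a b → a ≤ m → b ≤ m → P (pos a) < P (pos b) → toFun m τ a < toFun m τ b
  reflects a b _ _ lt = Equivalence.from (f-order (toFin m a) (toFin m b))
    (subst₂ _<_ (sym (toℕ-lookup-mk P-bounded (f (toFin m a)))) (sym (toℕ-lookup-mk P-bounded (f (toFin m b)))) lt)

mk-avoids : ∀ {T N P} → Bounded N P → ¬ T 0 [] → (∀ m τ → T (suc m) τ → ¬ Occurrence N m P τ) →
            Avoids T (mk N P)
mk-avoids P-bounded ¬T[] no-occurrence zero    []  T[] _ _        = ¬T[] T[]
mk-avoids P-bounded ¬T[] no-occurrence (suc m) τ   Tτ  _ contains =
  no-occurrence m τ Tτ (contains⇒occurrence P-bounded contains)

module _ {N m P τ} (o : Occurrence N m P τ) where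
  open Occurrence o

  -- toFun m τ ∘ g′ is then an increasing self-map of [0..m], hence the identity.
  occurrence-pattern : ∀ {g g′} → InverseOn m g g′ → IncreasingOn m (P ∘ pos ∘ g′) → τ ≡ mk m g
  occurrence-pattern {g} {g′} g⇔g′ sorted = trans (mk-toFun m τ) (mk-cong τ≗g)
    where
    open InverseOn g⇔g′
    τ∘g′≗id : ∀ c → c ≤ m → toFun m τ (g′ c) ≡ c
    τ∘g′≗id = increasing-self-map⇒id
      (λ c d c<d d≤m → reflects _ _ (from-bounded c (<⇒≤ (<-≤-trans c<d d≤m))) (from-bounded d d≤m)
                                    (sorted c d c<d d≤m))
      (λ c c≤m → toFun-bounded m τ (g′ c) (from-bounded c c≤m))
    τ≗g : ∀ a → a ≤ m → toFun m τ a ≡ g a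
    τ≗g a a≤m = trans (cong (toFun m τ) (sym (from∘to a a≤m))) (τ∘g′≗id (g a) (to-bounded a a≤m))

module _ {N m x y τ} (o : Occurrence N m (swap x y) τ) where
  open Occurrence o

  swap-pattern : ∀ {a b} → a ≤ m → b ≤ m → pos a ≡ x → pos b ≡ y → τ ≡ mk m (swap a b)
  swap-pattern {a} {b} a≤m b≤m pos-a≡x pos-b≡y = occurrence-pattern o (swap-inverse a≤m b≤m) λ c d c<d d≤m →
    subst₂ _<_ (sym (commutes c (<⇒≤ (<-≤-trans c<d d≤m)))) (sym (commutes d d≤m)) (pos-increasing c d c<d d≤m)
    where
    commutes : ∀ c → c ≤ m → swap x y (pos (swap a b c)) ≡ pos c
    commutes c c≤m = begin
      swap x y (pos (swap a b c))              ≡⟨ cong (swap x y) (swap-natural (increasing-injective pos-increasing)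
                                                                                a≤m b≤m c≤m) ⟩
      swap x y (swap (pos a) (pos b) (pos c))  ≡⟨ cong₂ (λ u v → swap x y (swap u v (pos c))) pos-a≡x pos-b≡y ⟩
      swap x y (swap x y (pos c))              ≡⟨ swap-involutive x y (pos c) ⟩
      pos c                                    ∎
      where open ≡-Reasoning

module _ {N m τ} (o : Occurrence N m (cycle N) τ) where
  open Occurrence o

  cycle-patterns : τ ≡ idP m ⊎ τ ≡ wP m
  cycle-patterns with pos m ≟ N
  ... | no last≢N = inj₁ (occurrence-pattern o id-inverse λ a b a<b b≤m →
    subst₂ _<_ (sym (cycle-< (pos<N-when-last≢N last≢N (<⇒≤ (<-≤-trans a<b b≤m)))))
               (sym (cycle-< (pos<N-when-last≢N last≢N b≤m))) (s≤s (pos-increasing a b a<b b≤m)))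
  ... | yes last≡N = inj₂ (occurrence-pattern o (cycle-inverse m) (∘cycle⁻¹-increasing inner last))
    where
    inner : ∀ a b → a < b → b < m → cycle N (pos a) < cycle N (pos b)
    inner a b a<b b<m = subst₂ _<_ (sym (cycle-< (pos<N-before-last (<-trans a<b b<m))))
      (sym (cycle-< (pos<N-before-last b<m))) (s≤s (pos-increasing a b a<b (<⇒≤ b<m)))
    last : ∀ b → b < m → cycle N (pos m) < cycle N (pos b)
    last b b<m = subst₂ _<_ (sym (trans (cong (cycle N) last≡N) (cycle-last N)))
      (sym (cycle-< (pos<N-before-last b<m))) (s≤s z≤n)

module _ {N m τ} (o : Occurrence N m (swap 0 N) τ) where
  open Occurrence o

  private
    fixed : ∀ {a} → 0 < pos a → pos a < N → swap 0 N (pos a) ≡ pos a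
    fixed 0<pos-a pos-a<N = swap-other (>⇒≢ 0<pos-a) (<⇒≢ pos-a<N)

    fixed-< : ∀ {a b} → 0 < pos a → pos b < N → a < b → b ≤ m → swap 0 N (pos a) < swap 0 N (pos b)
    fixed-< {a} {b} 0<pos-a pos-b<N a<b b≤m = subst₂ _<_
      (sym (fixed 0<pos-a (<-trans pos-a<pos-b pos-b<N))) (sym (fixed (<-trans 0<pos-a pos-a<pos-b) pos-b<N))
      pos-a<pos-b
      where
      pos-a<pos-b : pos a < pos b
      pos-a<pos-b = pos-increasing a b a<b b≤m

  end-swap-patterns : τ ≡ uP m ⊎ τ ≡ vP m ⊎ τ ≡ wP m ⊎ τ ≡ idP m
  end-swap-patterns with pos 0 ≟ 0 | pos m ≟ N
  ... | yes first≡0 | yes last≡N = inj₁ (swap-pattern o z≤n ≤-refl first≡0 last≡N)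
  ... | yes first≡0 | no  last≢N = inj₂ (inj₁ (occurrence-pattern o (inverseOn-sym (cycle-inverse m))
                                                  (∘cycle-increasing {φ = swap 0 N ∘ pos} inner last)))
    where
    inner : ∀ a b → a < b → b < m → swap 0 N (pos (suc a)) < swap 0 N (pos (suc b))
    inner a b a<b b<m = fixed-< (pos>0-after-first (s≤s z≤n) (<⇒≤ (≤-<-trans a<b b<m)))
                                (pos<N-when-last≢N last≢N b<m) (s≤s a<b) b<m
    last : ∀ a → a < m → swap 0 N (pos (suc a)) < swap 0 N (pos 0)
    last a a<m = subst₂ _<_ (sym (fixed (pos>0-after-first (s≤s z≤n) a<m) (pos<N-when-last≢N last≢N a<m)))
      (sym (trans (cong (swap 0 N) first≡0) (swap-left 0 N))) (pos<N-when-last≢N last≢N a<m)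
  ... | no  first≢0 | yes last≡N = inj₂ (inj₂ (inj₁ (occurrence-pattern o (cycle-inverse m)
                                                        (∘cycle⁻¹-increasing {φ = swap 0 N ∘ pos} inner last))))
    where
    inner : ∀ a b → a < b → b < m → swap 0 N (pos a) < swap 0 N (pos b)
    inner a b a<b b<m =
      fixed-< (pos>0-when-first≢0 first≢0 (<⇒≤ (<-trans a<b b<m))) (pos<N-before-last b<m) a<b (<⇒≤ b<m)
    last : ∀ b → b < m → swap 0 N (pos m) < swap 0 N (pos b)
    last b b<m = subst₂ _<_ (sym (trans (cong (swap 0 N) last≡N) (swap-right 0 N)))
      (sym (fixed (pos>0-when-first≢0 first≢0 (<⇒≤ b<m)) (pos<N-before-last b<m)))
      (pos>0-when-first≢0 first≢0 (<⇒≤ b<m))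
  ... | no  first≢0 | no  last≢N = inj₂ (inj₂ (inj₂ (occurrence-pattern o id-inverse λ a b a<b b≤m →
    fixed-< (pos>0-when-first≢0 first≢0 (<⇒≤ (<-≤-trans a<b b≤m))) (pos<N-when-last≢N last≢N b≤m) a<b b≤m)))

module _ {N m c τ} (o : Occurrence N m (swap c (suc c)) τ) where
  open Occurrence o

  -- The bounds on e force e = 0 when c = 0, and m = suc e when suc c = N.
  adjacent-patterns : τ ≡ idP m ⊎ Σ ℕ λ e → e < m × e ≤ c × (suc e < m → suc c < N) × τ ≡ tP m (2 + e)
  adjacent-patterns with anyUpTo? (λ e → (pos e ≟ c) ×-dec (pos (suc e) ≟ suc c)) m
  ... | yes (e , e<m , pos-e≡c , pos-1+e≡1+c) =
    inj₂ (e , e<m , e≤c , not-last , swap-pattern o (<⇒≤ e<m) e<m pos-e≡c pos-1+e≡1+c)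
    where
    e≤c : e ≤ c
    e≤c = subst (e ≤_) pos-e≡c (increasing-inflationary pos-increasing e (<⇒≤ e<m))
    not-last : suc e < m → suc c < N
    not-last 1+e<m = subst (_< N) pos-1+e≡1+c (<-≤-trans (pos-increasing _ m 1+e<m ≤-refl) (pos-bounded m))
  ... | no ¬adjacent = inj₁ (occurrence-pattern o id-inverse λ a b a<b b≤m →
    swap-adjacent-< (pos-increasing a b a<b b≤m) (¬c,1+c a<b b≤m))
    where
    -- pos a = c and pos b = suc c leave no room for pos (suc a) but suc c.
    ¬c,1+c : ∀ {a b} → a < b → b ≤ m → ¬ (pos a ≡ c × pos b ≡ suc c)
    ¬c,1+c {a} {b} a<b b≤m (pos-a≡c , pos-b≡1+c) = ¬adjacent (a , <-≤-trans a<b b≤m , pos-a≡c , pos-1+a≡1+c)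
      where
      pos-1+a≡1+c : pos (suc a) ≡ suc c
      pos-1+a≡1+c = ≤-antisym (subst (pos (suc a) ≤_) pos-b≡1+c (increasing-monotone pos-increasing a<b b≤m))
                              (subst (_< pos (suc a)) pos-a≡c (pos-increasing a (suc a) ≤-refl (≤-trans a<b b≤m)))

-- Sufficient conditions

module _ (T : PatternSet) (¬T[] : ¬ T 0 []) (¬id : ∀ m → ¬ T (suc m) (idP m)) where

  cycle-avoids : (∀ m → ¬ T (suc m) (wP m)) → ∀ N → Avoids T (mk N (cycle N))
  cycle-avoids ¬w N = mk-avoids (InverseOn.to-bounded (cycle-inverse N)) ¬T[] no-occurrence
    where
    no-occurrence : ∀ m τ → T (suc m) τ → ¬ Occurrence N m (cycle N) τ
    no-occurrence m τ Tτ o with cycle-patterns o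
    ... | inj₁ refl = ¬id m Tτ
    ... | inj₂ refl = ¬w m Tτ

  end-swap-avoids : (∀ m → ¬ T (suc m) (uP m)) → (∀ m → ¬ T (suc m) (vP m)) → (∀ m → ¬ T (suc m) (wP m)) →
                    ∀ N → Avoids T (mk N (swap 0 N))
  end-swap-avoids ¬u ¬v ¬w N = mk-avoids (swap-bounded z≤n ≤-refl) ¬T[] no-occurrence
    where
    no-occurrence : ∀ m τ → T (suc m) τ → ¬ Occurrence N m (swap 0 N) τ
    no-occurrence m τ Tτ o with end-swap-patterns o
    ... | inj₁ refl               = ¬u m Tτ
    ... | inj₂ (inj₁ refl)        = ¬v m Tτ
    ... | inj₂ (inj₂ (inj₁ refl)) = ¬w m Tτ
    ... | inj₂ (inj₂ (inj₂ refl)) = ¬id m Tτ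

  adjacent-avoids : ∀ N c → suc c ≤ N →
                    (∀ m e → e < m → e ≤ c → (suc e < m → suc c < N) → ¬ T (suc m) (tP m (2 + e))) →
                    Avoids T (mk N (swap c (suc c)))
  adjacent-avoids N c c<N ¬t = mk-avoids (swap-bounded (<⇒≤ c<N) c<N) ¬T[] no-occurrence
    where
    no-occurrence : ∀ m τ → T (suc m) τ → ¬ Occurrence N m (swap c (suc c)) τ
    no-occurrence m τ Tτ o with adjacent-patterns o
    ... | inj₁ refl                              = ¬id m Tτ
    ... | inj₂ (e , e<m , e≤c , not-last , refl) = ¬t m e e<m e≤c not-last Tτ

  module _ (N : ℕ) where
    open GeneratedSubgroup {N} (λ σ → Avoids T σ)

    avoiding-generated : ∀ {P Q} → InverseOn N P Q → Avoids T (mk N P) → Generated P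
    avoiding-generated P⇔Q avoids = gen avoids (mk-isPerm to-bounded to-injective)
      where open InverseOn P⇔Q

    generatesSym-by-cycle-and-end-swap : (∀ m → ¬ T (suc m) (uP m)) → (∀ m → ¬ T (suc m) (vP m)) →
                                         (∀ m → ¬ T (suc m) (wP m)) → GeneratesSym T (suc N)
    generatesSym-by-cycle-and-end-swap ¬u ¬v ¬w =
      generated-all (generated-adjacent gcycle (generated-first gcycle gend))
      where
      gcycle : Generated (cycle N)
      gcycle = avoiding-generated (cycle-inverse N) (cycle-avoids ¬w N)
      gend : Generated (swap 0 N)
      gend = avoiding-generated (swap-inverse z≤n ≤-refl) (end-swap-avoids ¬u ¬v ¬w N)

    generatesSym-by-adjacent : (∀ m r → 2 ≤ r → r ≤ suc m → ¬ T (suc m) (tP m r)) → GeneratesSym T (suc N)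
    generatesSym-by-adjacent ¬t = generated-all λ c c<N →
      avoiding-generated (swap-inverse (<⇒≤ c<N) c<N)
        (adjacent-avoids N c c<N λ m e e<m _ _ → ¬t m (2 + e) (s≤s (s≤s z≤n)) (s≤s e<m))

    generatesSym-by-cycle-and-first-adjacent : (∀ m → ¬ T (suc m) (wP m)) →
                                               (∀ m → ¬ T (suc (suc m)) (xP m)) → GeneratesSym T (suc N)
    generatesSym-by-cycle-and-first-adjacent ¬w ¬x =
      generated-all (generated-adjacent (avoiding-generated (cycle-inverse N) (cycle-avoids ¬w N)) gfirst)
      where
      ¬t : ∀ m e → e < m → e ≤ 0 → (suc e < m → 1 < N) → ¬ T (suc m) (tP m (2 + e))
      ¬t (suc m) zero _ z≤n _ = ¬x m
      gfirst : 1 ≤ N → Generated (swap 0 1)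
      gfirst 1≤N = avoiding-generated (swap-inverse z≤n 1≤N) (adjacent-avoids N 0 1≤N ¬t)

    generatesSym-by-cycle-and-last-adjacent : (∀ m → ¬ T (suc m) (wP m)) →
                                              (∀ m → ¬ T (suc (suc m)) (yP m)) → GeneratesSym T (suc N)
    generatesSym-by-cycle-and-last-adjacent ¬w ¬y = generated-all (generated-adjacent gcycle gfirst)
      where
      gcycle : Generated (cycle N)
      gcycle = avoiding-generated (cycle-inverse N) (cycle-avoids ¬w N)
      ¬t : ∀ c → suc c ≡ N → ∀ m e → e < m → e ≤ c → (suc e < m → suc c < N) → ¬ T (suc m) (tP m (2 + e))
      ¬t c refl m e e<m _ not-last with m≤n⇒m<n∨m≡n e<m
      ... | inj₁ 1+e<m = ⊥-elim (<-irrefl refl (not-last 1+e<m))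
      ... | inj₂ refl  = ¬y e
      gfirst : 1 ≤ N → Generated (swap 0 1)
      gfirst (s≤s {n = c} z≤n) = generated-first gcycle (generated-end gcycle c refl
        (avoiding-generated (swap-inverse (n≤1+n c) ≤-refl) (adjacent-avoids N c ≤-refl (¬t c refl)))) (s≤s z≤n)

sufficient-conditions : (T : PatternSet) → ¬ T 0 [] → (CondA T ⊎ CondB T ⊎ CondC T ⊎ CondD T) →
                        ∀ n → GeneratesSym T n
sufficient-conditions T ¬T[] _ zero [] _ = one
sufficient-conditions T ¬T[] (inj₁ a) (suc N) =
  generatesSym-by-cycle-and-end-swap T ¬T[] (proj₂ ∘ proj₂ ∘ proj₂ ∘ a) N
    (proj₁ ∘ a) (proj₁ ∘ proj₂ ∘ a) (proj₁ ∘ proj₂ ∘ proj₂ ∘ a)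
sufficient-conditions T ¬T[] (inj₂ (inj₁ (¬id , ¬t))) (suc N) = generatesSym-by-adjacent T ¬T[] ¬id N ¬t
sufficient-conditions T ¬T[] (inj₂ (inj₂ (inj₁ c))) (suc N) =
  generatesSym-by-cycle-and-first-adjacent T ¬T[] (proj₁ ∘ proj₂ ∘ c) N (proj₁ ∘ c) (proj₂ ∘ proj₂ ∘ c)
sufficient-conditions T ¬T[] (inj₂ (inj₂ (inj₂ d))) (suc N) =
  generatesSym-by-cycle-and-last-adjacent T ¬T[] (proj₁ ∘ proj₂ ∘ d) N (proj₁ ∘ d) (proj₂ ∘ proj₂ ∘ d)

-- Patterns of a single length

other-length-absent : ∀ {T k j} {τ : Vec (Fin j) j} → SubsetOfS T k → j ≢ k → ¬ T j τ
other-length-absent T⊆Sₖ j≢k Tτ = j≢k (T⊆Sₖ _ _ Tτ)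

absent-family : ∀ {T} (ℓ : ℕ → ℕ) → (∀ {i j} → ℓ i ≡ ℓ j → i ≡ j) →
                (σ : ∀ m → Vec (Fin (ℓ m)) (ℓ m)) → ∀ {k} → SubsetOfS T (ℓ k) → ¬ T (ℓ k) (σ k) → ∀ m → ¬ T (ℓ m) (σ m)
absent-family ℓ ℓ-injective σ {k} T⊆S ¬σₖ m with m ≟ k
... | yes refl = ¬σₖ
... | no  m≢k  = other-length-absent T⊆S (m≢k ∘ ℓ-injective)

adjacentTranspositions : ∀ m → ℕ → List (Vec (Fin (suc m)) (suc m))
adjacentTranspositions m zero    = []
adjacentTranspositions m (suc j) = tP m (2 + j) ∷ adjacentTranspositions m j

all-adjacentTranspositions : ∀ {T : PatternSet} {m} j → All (λ σ → ¬ T (suc m) σ) (adjacentTranspositions m j) →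
                             ∀ r → 2 ≤ r → r ≤ suc j → ¬ T (suc m) (tP m r)
all-adjacentTranspositions zero [] r 2≤r r≤1 = ⊥-elim (<-irrefl refl (≤-trans 2≤r r≤1))
all-adjacentTranspositions {T} (suc j) (¬t ∷ ¬ts) r 2≤r r≤2+j with m≤n⇒m<n∨m≡n r≤2+j
... | inj₁ r<2+j = all-adjacentTranspositions {T} j ¬ts r 2≤r (≤-pred r<2+j)
... | inj₂ refl  = ¬t

necessary-conditions : ∀ k (T : PatternSet) → SubsetOfS T (2 + k) → ∀ n → ¬ GeneratesSym T n →
    Meets T (2 + k) (idP (suc k) ∷ wP (suc k) ∷ vP (suc k) ∷ uP (suc k) ∷ [])
  × Meets T (2 + k) (idP (suc k) ∷ adjacentTranspositions (suc k) (suc k))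
  × Meets T (2 + k) (idP (suc k) ∷ xP k ∷ wP (suc k) ∷ [])
  × Meets T (2 + k) (idP (suc k) ∷ yP k ∷ wP (suc k) ∷ [])
necessary-conditions k T T⊆S n ¬generates = meets-a , meets-b , meets-c , meets-d
  where
  ¬T[] : ¬ T 0 []
  ¬T[] = other-length-absent T⊆S λ ()
  absent : (σ : ∀ m → Vec (Fin (suc m)) (suc m)) → ¬ T (2 + k) (σ (suc k)) → ∀ m → ¬ T (suc m) (σ m)
  absent σ = absent-family suc suc-injective σ T⊆S
  absent₂ : (σ : ∀ m → Vec (Fin (2 + m)) (2 + m)) → ¬ T (2 + k) (σ k) → ∀ m → ¬ T (2 + m) (σ m)
  absent₂ σ = absent-family (2 +_) (suc-injective ∘ suc-injective) σ T⊆S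

  meets-a : Meets T (2 + k) (idP (suc k) ∷ wP (suc k) ∷ vP (suc k) ∷ uP (suc k) ∷ [])
  meets-a (¬id ∷ ¬w ∷ ¬v ∷ ¬u ∷ []) = ¬generates (sufficient-conditions T ¬T[] (inj₁ λ m →
    absent uP ¬u m , absent vP ¬v m , absent wP ¬w m , absent idP ¬id m) n)

  meets-b : Meets T (2 + k) (idP (suc k) ∷ adjacentTranspositions (suc k) (suc k))
  meets-b (¬id ∷ ¬ts) = ¬generates (sufficient-conditions T ¬T[] (inj₂ (inj₁ (absent idP ¬id , ¬t))) n)
    where
    ¬t : ∀ m r → 2 ≤ r → r ≤ suc m → ¬ T (suc m) (tP m r)
    ¬t m r 2≤r r≤1+m with m ≟ suc k
    ... | yes refl  = all-adjacentTranspositions {T} (suc k) ¬ts r 2≤r r≤1+m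
    ... | no  m≢1+k = other-length-absent T⊆S (m≢1+k ∘ suc-injective)

  meets-c : Meets T (2 + k) (idP (suc k) ∷ xP k ∷ wP (suc k) ∷ [])
  meets-c (¬id ∷ ¬x ∷ ¬w ∷ []) = ¬generates (sufficient-conditions T ¬T[] (inj₂ (inj₂ (inj₁ λ m →
    absent wP ¬w m , absent idP ¬id m , absent₂ xP ¬x m))) n)

  meets-d : Meets T (2 + k) (idP (suc k) ∷ yP k ∷ wP (suc k) ∷ [])
  meets-d (¬id ∷ ¬y ∷ ¬w ∷ []) = ¬generates (sufficient-conditions T ¬T[] (inj₂ (inj₂ (inj₂ λ m →
    absent wP ¬w m , absent idP ¬id m , absent₂ yP ¬y m))) n)

theorem6p1 : ((T : PatternSet) → ¬ T 0 [] → (CondA T ⊎ CondB T ⊎ CondC T ⊎ CondD T) →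
      ∀ n → GeneratesSym T n)
    × ((T : PatternSet) → SubsetOfS T 3 → (n : ℕ) → ¬ GeneratesSym T n →
        Meets T 3 (p3 0 1 2 ∷ p3 1 2 0 ∷ p3 2 0 1 ∷ p3 2 1 0 ∷ [])
        × Meets T 3 (p3 0 1 2 ∷ p3 0 2 1 ∷ p3 1 0 2 ∷ [])
        × Meets T 3 (p3 0 1 2 ∷ p3 1 0 2 ∷ p3 1 2 0 ∷ [])
        × Meets T 3 (p3 0 1 2 ∷ p3 0 2 1 ∷ p3 1 2 0 ∷ []))
    × ((T : PatternSet) → SubsetOfS T 4 → (n : ℕ) → ¬ GeneratesSym T n →
        Meets T 4 (p4 0 1 2 3 ∷ p4 1 2 3 0 ∷ p4 3 0 1 2 ∷ p4 3 1 2 0 ∷ [])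
        × Meets T 4 (p4 0 1 2 3 ∷ p4 0 1 3 2 ∷ p4 0 2 1 3 ∷ p4 1 0 2 3 ∷ [])
        × Meets T 4 (p4 0 1 2 3 ∷ p4 1 0 2 3 ∷ p4 1 2 3 0 ∷ [])
        × Meets T 4 (p4 0 1 2 3 ∷ p4 0 1 3 2 ∷ p4 1 2 3 0 ∷ []))
theorem6p1 = sufficient-conditions , necessary-conditions 1 , necessary-conditions 2
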